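{- The competitive ratio of the Move-All-Equally algorithm for $r$-uniform Online Min-Sum Set Cover against the static optimum is $\Omega(r^2)$; that is, there is an absolute constant $c>0$ such that for every $r$ there are universe sizes $n$ for which the competitive ratio of Move-All-Equally is at least $c\,r^2$.
   Context: Let $U$ be a set of $n$ elements; a permutation $\pi$ of $U$ gives each element $e$ a position $\pi[e]\in\{1,\dots,n\}$, and for nonempty $S\subseteq U$, $\pi(S)=\min_{e\in S}\pi[e]$. $d_{KT}(\pi,\sigma)$ is the number of pairs of elements ordered differently by $\pi,\sigma$. In $r$-uniform Online Min-Sum Set Cover, starting from an initial permutation $\pi_0$, request sets $S_1,\dots,S_m\subseteq U$ with $|S_t|=r$ arrive online; on arrival of $S_t$ an algorithm holding $\pi_{t-1}$ pays $\pi_{t-1}(S_t)$ and then moves to $\pi_t$ paying $d_{KT}(\pi_{t-1},\pi_t)$. The static optimum is $\mathrm{OPT}=\min_\pi\sum_t\pi(S_t)$. An algorithm is $c$-competitive if its total cost is at most $c\cdot\mathrm{OPT}+\alpha$ for all initial permutations and sequences, for some $\alpha$ independent of the sequence (possibly depending on $n,r$); the competitive ratio is the infimum of such $c$. Move-All-Equally: given current permutation $\pi$ and request $S$, let $k=\pi(S)$; the new permutation $\pi'$ places each $e\in S$ at position $\pi'[e]=\pi[e]-(k-1)$, and the elements of $U\setminus S$ fill the remaining positions in the same relative order as in $\pi$. -}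

module Defs where

open import Data.Nat using (ℕ; zero; suc; _+_; _∸_; _⊓_; _<ᵇ_)
open import Data.Bool using (Bool; true; false; if_then_else_; _xor_; not)
open import Data.Fin using (Fin; toℕ)
open import Data.Fin.Properties using (_≟_)
open import Data.Fin.Subset using (Subset)
open import Data.Vec using (lookup)
open import Data.List using (List; []; _∷_; map; foldr; filterᵇ; allFin; drop; replicate; _++_; length; concatMap)
open import Data.Nat.ListAction using (sum)
open import Data.Maybe using (Maybe; just; nothing)
open import Data.Product using (_×_; _,_)
open import Data.Integer using (+_)
open import Data.Rational using (ℚ; _/_)
open import Data.List.Relation.Binary.Permutation.Propositional using (_↭_)
open import Relation.Nullary using (does)

-- A permutation of U = Fin n is represented by its ordering list:
-- the element at position i (1-based) is the i-th entry of the list.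
Ordering : ℕ → Set
Ordering n = List (Fin n)

IsPerm : ∀ {n} → Ordering n → Set
IsPerm {n} L = L ↭ allFin n

inS : ∀ {n} → Subset n → Fin n → Bool
inS S e = lookup S e

pos : ∀ {n} → Ordering n → Fin n → ℕ
pos [] e = 1
pos (x ∷ xs) e = if does (x ≟ e) then 1 else suc (pos xs e)

-- π(S) = min_{e ∈ S} π[e]  (the default suc n is never attained for nonempty S)
hit : ∀ {n} → Ordering n → Subset n → ℕ
hit {n} L S = foldr _⊓_ (suc n) (map (pos L) (filterᵇ (inS S) (allFin n)))

dKT : ∀ {n} → Ordering n → Ordering n → ℕ
dKT {n} L M =
  length (filterᵇ disagree
           (concatMap (λ i → map (λ j → (i , j)) (allFin n)) (allFin n)))
  where
    disagree : Fin n × Fin n → Bool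
    disagree (i , j) =
      if toℕ i <ᵇ toℕ j
      then ((pos L i <ᵇ pos L j) xor (pos M i <ᵇ pos M j))
      else false

-- Move-All-Equally step: with k = π(S), each e ∈ S moves to position π[e] - (k-1);
-- the remaining elements fill the free positions in their old relative order.
fill : ∀ {n} → List (Maybe (Fin n)) → List (Fin n) → List (Fin n)
fill [] ys = []
fill (just e ∷ rest) ys = e ∷ fill rest ys
fill (nothing ∷ rest) [] = []
fill (nothing ∷ rest) (y ∷ ys) = y ∷ fill rest ys

maeStep : ∀ {n} → Ordering n → Subset n → Ordering n
maeStep L S =
  fill (map (λ x → if inS S x then just x else nothing) (drop (k ∸ 1) L)
          ++ replicate (k ∸ 1) nothing)
       (filterᵇ (λ x → not (inS S x)) L)
  where k = hit L S

maeCost : ∀ {n} → Ordering n → List (Subset n) → ℕ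
maeCost L [] = 0
maeCost L (S ∷ Ss) = hit L S + dKT L (maeStep L S) + maeCost (maeStep L S) Ss

staticCost : ∀ {n} → Ordering n → List (Subset n) → ℕ
staticCost σ Ss = sum (map (hit σ) Ss)

ℕ→ℚ : ℕ → ℚ
ℕ→ℚ m = (+ m) / 1

-- Split U = Fin (2r) into halves lo and hi, start from the order hi ++ lo and
-- request lo, hi, lo, hi, ...  Each request is the block standing right behind
-- the other half, so Move-All-Equally moves it to the front: it swaps the two
-- halves and pays r² in Kendall tau distance every time.  The static order
-- h₀ ∷ lo ++ (hi without h₀) pays only 1 + 2 per pair of requests, and this is
-- optimal because the first element of any order misses one of the two halves,
-- which then costs at least 2.  After q pairs the ratio is 2r²q / 3q, and
-- q = α + 1 pairs swamp any additive constant α; hence the constant 1/3.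

module Submission where

open import Defs

-- A separate module, since here _+_ and _<_ are those of ℕ while the statement
-- of theorem3 uses the ones of ℚ.
module MoveAllEqually where

  open import Data.Nat as ℕ using (ℕ; zero; suc; _+_; _*_; _∸_; _≤_; _<_; z≤n; s≤s; _<ᵇ_)
  import Data.Nat.Properties as ℕ
  import Data.Nat.GCD as ℕ
  import Data.Nat.Coprimality as ℕ
  import Data.Integer as ℤ
  import Data.Integer.Properties as ℤ
  open import Data.Rational as ℚ using (mkℚ; 1ℚ)
  import Data.Rational.Properties as ℚ
  import Data.Rational.Unnormalised as ℚᵘ
  import Data.Rational.Unnormalised.Properties as ℚᵘ
  open import Algebra.Bundles using (CommutativeMonoid)
  open import Algebra.Properties.CommutativeSemigroup (CommutativeMonoid.commutativeSemigroup ℚ.*-1-commutativeMonoid)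
    using (interchange)
  open import Data.Bool using (Bool; true; false; if_then_else_; not; _xor_)
  open import Data.Bool.Properties using (T-≡; T-not-≡; xor-comm)
  open import Data.Fin using (Fin; zero; suc; toℕ; _↑ˡ_; _↑ʳ_)
  open import Data.Fin.Properties using (_≟_; toℕ<n; toℕ-↑ˡ; toℕ-↑ʳ)
  open import Data.Fin.Subset using (Subset; ∁; ⊤; ⊥; ∣_∣)
  open import Data.Fin.Subset.Properties using (∣⊥∣≡0; ∣∁p∣≡n∸∣p∣)
  open import Data.List
    using (List; []; _∷_; _++_; length; map; filterᵇ; allFin; drop; replicate; concatMap; cartesianProduct; tabulate)
  import Data.List.Properties as List
  open import Data.List.Membership.Propositional using (_∈_)
  open import Data.List.Membership.Propositional.Properties using (∈-filter⁺; ∈-allFin)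
  open import Data.List.Relation.Unary.All as All using (All; []; _∷_)
  import Data.List.Relation.Unary.All.Properties as All
  open import Data.List.Relation.Unary.Any as Any using (here; there)
  import Data.List.Relation.Unary.Any.Properties as Any
  open import Data.List.Relation.Binary.Sublist.Propositional using (_⊆_; []; _∷_; _∷ʳ_; ⊆-refl)
  open import Data.List.Relation.Binary.Sublist.Propositional.Properties
    using (++⁺; ++⁺ˡ; ++⁺ʳ; map⁺; filter⁺; length-mono-≤; []⊆-universal)
  open import Data.List.Relation.Binary.Permutation.Propositional using (_↭_; ↭-sym)
  open import Data.List.Relation.Binary.Permutation.Propositional.Properties using (shift; ++-comm; ↭-length)
  open import Data.Maybe using (just; nothing)
  open import Data.Product using (_×_; _,_)
  open import Data.Sum using ([_,_]′; inj₂)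
  import Data.Vec as Vec
  import Data.Vec.Properties as Vec
  open import Function using (id; _∘_; Equivalence)
  open import Relation.Binary.PropositionalEquality
  open import Relation.Nullary using (does; yes; no; contradiction)
  open import Relation.Nullary.Reflects using (ofʸ)
  open import Relation.Nullary.Decidable using (T?)

  private
    variable
      n : ℕ

  1≤pos : ∀ (L : Ordering n) e → 1 ≤ pos L e
  1≤pos []      e = s≤s z≤n
  1≤pos (x ∷ L) e with does (x ≟ e)
  ... | true  = s≤s z≤n
  ... | false = s≤s z≤n

  pos-∷-≡ : ∀ e (L : Ordering n) → pos (e ∷ L) e ≡ 1
  pos-∷-≡ e L with e ≟ e
  ... | yes _   = refl
  ... | no e≢e = contradiction refl e≢e

  pos-∷-≢ : ∀ {x e} (L : Ordering n) → x ≢ e → pos (x ∷ L) e ≡ suc (pos L e)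
  pos-∷-≢ {x = x} {e} L x≢e with x ≟ e
  ... | yes x≡e = contradiction x≡e x≢e
  ... | no _    = refl

  pos-∷-≤ : ∀ x (L : Ordering n) e → pos (x ∷ L) e ≤ suc (pos L e)
  pos-∷-≤ x L e with does (x ≟ e)
  ... | true  = s≤s z≤n
  ... | false = ℕ.≤-refl

  pos-++-∉ : ∀ xs (ys : Ordering n) {e} → All (_≢ e) xs → pos (xs ++ ys) e ≡ length xs + pos ys e
  pos-++-∉ []       ys _            = refl
  pos-++-∉ (x ∷ xs) ys (x≢e ∷ xs∌e) = trans (pos-∷-≢ (xs ++ ys) x≢e) (cong suc (pos-++-∉ xs ys xs∌e))

  pos-++-∈ : ∀ {xs} (ys : Ordering n) {e} → e ∈ xs → pos (xs ++ ys) e ≤ length xs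
  pos-++-∈ {xs = x ∷ xs} ys (here refl) = ℕ.≤-trans (ℕ.≤-reflexive (pos-∷-≡ x (xs ++ ys))) (s≤s z≤n)
  pos-++-∈ {xs = x ∷ xs} ys {e} (there e∈xs) = ℕ.≤-trans (pos-∷-≤ x (xs ++ ys) e) (s≤s (pos-++-∈ ys e∈xs))

  pos-++-< : ∀ {xs} (ys : Ordering n) {i j} → i ∈ xs → All (_≢ j) xs → pos (xs ++ ys) i < pos (xs ++ ys) j
  pos-++-< {xs = xs} ys {i} {j} i∈xs xs∌j = begin-strict
    pos (xs ++ ys) i     ≤⟨ pos-++-∈ ys i∈xs ⟩
    length xs            <⟨ ℕ.m<m+n (length xs) (1≤pos ys j) ⟩
    length xs + pos ys j ≡⟨ pos-++-∉ xs ys xs∌j ⟨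
    pos (xs ++ ys) j     ∎
    where open ℕ.≤-Reasoning

  ∉-≢ : ∀ (S : Subset n) {x z} → inS S x ≡ false → inS S z ≡ true → x ≢ z
  ∉-≢ S x∉S z∈S refl with () ← trans (sym x∉S) z∈S

  hit-≥ : ∀ (L : Ordering n) S {v} → v ≤ suc n → (∀ z → inS S z ≡ true → v ≤ pos L z) → v ≤ hit L S
  hit-≥ {n} L S {v} v≤1+n bound = List.foldr-preservesᵇ {P = v ≤_} ℕ.⊓-glb v≤1+n
    (All.map⁺ (All.map (λ {z} z∈S → bound z (Equivalence.to T-≡ z∈S)) (All.all-filter (T? ∘ inS S) (allFin n))))

  hit-≤ : ∀ (L : Ordering n) S {y} → inS S y ≡ true → hit L S ≤ pos L y
  hit-≤ {n} L S {y} y∈S = List.foldr-preservesᵒ {P = _≤ pos L y}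
    (λ a b → [ ℕ.≤-trans (ℕ.m⊓n≤m a b) , ℕ.≤-trans (ℕ.m⊓n≤n a b) ]′) (suc n) _
    (inj₂ (Any.map⁺ (Any.map (λ { refl → ℕ.≤-refl })
      (∈-filter⁺ (T? ∘ inS S) (∈-allFin y) (Equivalence.from T-≡ y∈S)))))

  1≤hit : ∀ (L : Ordering n) S → 1 ≤ hit L S
  1≤hit L S = hit-≥ L S (s≤s z≤n) (λ z _ → 1≤pos L z)

  2≤hit-∷-∉ : ∀ {x} (L : Ordering n) S → inS S x ≡ false → 2 ≤ hit (x ∷ L) S
  2≤hit-∷-∉ {suc n} {x} L S x∉S = hit-≥ (x ∷ L) S (s≤s (s≤s z≤n))
    (λ z z∈S → ℕ.≤-trans (s≤s (1≤pos L z)) (ℕ.≤-reflexive (sym (pos-∷-≢ L (∉-≢ S x∉S z∈S)))))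

  hit-++ : ∀ xs y ys (S : Subset n) → length xs ≤ n → All (λ x → inS S x ≡ false) xs → inS S y ≡ true →
    hit (xs ++ y ∷ ys) S ≡ suc (length xs)
  hit-++ xs y ys S |xs|≤n xs∩S=∅ y∈S = ℕ.≤-antisym
    (ℕ.≤-trans (hit-≤ L S y∈S) (ℕ.≤-reflexive pos-y))
    (hit-≥ L S (s≤s |xs|≤n) (λ z z∈S → begin
      suc (length xs)           ≡⟨ ℕ.+-comm 1 (length xs) ⟩
      length xs + 1             ≤⟨ ℕ.+-monoʳ-≤ (length xs) (1≤pos (y ∷ ys) z) ⟩
      length xs + pos (y ∷ ys) z ≡⟨ pos-++-∉ xs (y ∷ ys) (All.map (λ x∉S → ∉-≢ S x∉S z∈S) xs∩S=∅) ⟨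
      pos L z                   ∎))
    where
    open ℕ.≤-Reasoning
    L = xs ++ y ∷ ys
    pos-y : pos L y ≡ suc (length xs)
    pos-y = begin-equality
      pos L y                    ≡⟨ pos-++-∉ xs (y ∷ ys) (All.map (λ x∉S → ∉-≢ S x∉S y∈S) xs∩S=∅) ⟩
      length xs + pos (y ∷ ys) y ≡⟨ cong (length xs +_) (pos-∷-≡ y ys) ⟩
      length xs + 1              ≡⟨ ℕ.+-comm (length xs) 1 ⟩
      suc (length xs)            ∎

  inS-∁ : ∀ (S : Subset n) x → inS (∁ S) x ≡ not (inS S x)
  inS-∁ S x = Vec.lookup-map x not S

  3≤hit+hit-∁ : ∀ x (L : Ordering n) S → 3 ≤ hit (x ∷ L) S + hit (x ∷ L) (∁ S)
  3≤hit+hit-∁ x L S with inS S x in x∈?S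
  ... | true  = ℕ.+-mono-≤ (1≤hit (x ∷ L) S) (2≤hit-∷-∉ L (∁ S) (trans (inS-∁ S x) (cong not x∈?S)))
  ... | false = ℕ.+-mono-≤ {2} (2≤hit-∷-∉ L S x∈?S) (1≤hit (x ∷ L) (∁ S))

  -- maeStep with the shift k left abstract, so that a computed value of hit L S can be substituted.
  maeStepWith : ℕ → Ordering n → Subset n → Ordering n
  maeStepWith k L S =
    fill (map (λ x → if inS S x then just x else nothing) (drop (k ∸ 1) L) ++ replicate (k ∸ 1) nothing)
         (filterᵇ (λ x → not (inS S x)) L)

  drop-++ : ∀ {A : Set} (xs ys : List A) → drop (length xs) (xs ++ ys) ≡ ys
  drop-++ []       ys = refl
  drop-++ (x ∷ xs) ys = drop-++ xs ys

  fill-just-++ : ∀ (ys : Ordering n) R zs → fill (map just ys ++ R) zs ≡ ys ++ fill R zs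
  fill-just-++ []       R zs = refl
  fill-just-++ (y ∷ ys) R zs = cong (y ∷_) (fill-just-++ ys R zs)

  fill-nothing : ∀ (xs : Ordering n) → fill (replicate (length xs) nothing) xs ≡ xs
  fill-nothing []       = refl
  fill-nothing (x ∷ xs) = cong (x ∷_) (fill-nothing xs)

  maeStep-swap : ∀ xs y ys (S : Subset n) → length xs ≤ n →
    All (λ x → inS S x ≡ false) xs → All (λ z → inS S z ≡ true) (y ∷ ys) →
    maeStep (xs ++ y ∷ ys) S ≡ (y ∷ ys) ++ xs
  maeStep-swap xs y ys S |xs|≤n xs∩S=∅ y∷ys⊆S@(y∈S ∷ _) = begin
    maeStepWith (hit (xs ++ zs) S) (xs ++ zs) S
      ≡⟨ cong (λ k → maeStepWith k (xs ++ zs) S) (hit-++ xs y ys S |xs|≤n xs∩S=∅ y∈S) ⟩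
    fill (map mark (drop (length xs) (xs ++ zs)) ++ replicate (length xs) nothing) (filterᵇ outside (xs ++ zs))
      ≡⟨ cong₂ (λ as bs → fill (map mark as ++ replicate (length xs) nothing) bs) (drop-++ xs zs) outside-of-xs++zs ⟩
    fill (map mark zs ++ replicate (length xs) nothing) xs
      ≡⟨ cong (λ as → fill (as ++ replicate (length xs) nothing) xs)
           (List.map-cong-local (All.map (λ z∈S → cong (λ b → if b then just _ else nothing) z∈S) y∷ys⊆S)) ⟩
    fill (map just zs ++ replicate (length xs) nothing) xs
      ≡⟨ fill-just-++ zs _ xs ⟩
    zs ++ fill (replicate (length xs) nothing) xs
      ≡⟨ cong (zs ++_) (fill-nothing xs) ⟩
    zs ++ xs ∎
    where
    open ≡-Reasoning
    zs = y ∷ ys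
    mark = λ x → if inS S x then just x else nothing
    outside = λ x → not (inS S x)
    outside-of-xs++zs : filterᵇ outside (xs ++ zs) ≡ xs
    outside-of-xs++zs = begin
      filterᵇ outside (xs ++ zs)                  ≡⟨ List.filter-++ (T? ∘ outside) xs zs ⟩
      filterᵇ outside xs ++ filterᵇ outside zs    ≡⟨ cong₂ _++_
        (List.filter-all (T? ∘ outside) (All.map (Equivalence.from T-not-≡) xs∩S=∅))
        (List.filter-none (T? ∘ outside) (All.map (λ z∈S t → contradiction (Equivalence.to T-not-≡ t) (λ z∉S → ∉-≢ S z∉S z∈S refl)) y∷ys⊆S)) ⟩
      xs ++ []                                    ≡⟨ List.++-identityʳ xs ⟩
      xs                                          ∎

  disagreesOn : Ordering n → Ordering n → Fin n × Fin n → Bool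
  disagreesOn L M (i , j) =
    if toℕ i <ᵇ toℕ j then (pos L i <ᵇ pos L j) xor (pos M i <ᵇ pos M j) else false

  disagreesOn-comm : ∀ (L M : Ordering n) p → disagreesOn L M p ≡ disagreesOn M L p
  disagreesOn-comm L M (i , j) =
    cong (if toℕ i <ᵇ toℕ j then_else false) (xor-comm (pos L i <ᵇ pos L j) (pos M i <ᵇ pos M j))

  <ᵇ≡true : ∀ {a b} → a < b → (a <ᵇ b) ≡ true
  <ᵇ≡true = Equivalence.to T-≡ ∘ ℕ.<⇒<ᵇ

  <ᵇ≡false : ∀ {a b} → b ≤ a → (a <ᵇ b) ≡ false
  <ᵇ≡false {a} {b} b≤a with a <ᵇ b | ℕ.<ᵇ-reflects-< a b
  ... | false | _       = refl
  ... | true  | ofʸ a<b = contradiction a<b (ℕ.≤⇒≯ b≤a)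

  disagreesOn-inverted : ∀ (L M : Ordering n) {i j} → toℕ i < toℕ j →
    pos L i < pos L j → pos M j < pos M i → disagreesOn L M (i , j) ≡ true
  disagreesOn-inverted L M i<j Li<Lj Mj<Mi
    rewrite <ᵇ≡true i<j | <ᵇ≡true Li<Lj | <ᵇ≡false (ℕ.<⇒≤ Mj<Mi) = refl

  concatMap-pairs : ∀ {A B : Set} (xs : List A) (ys : List B) →
    concatMap (λ i → map (λ j → (i , j)) ys) xs ≡ cartesianProduct xs ys
  concatMap-pairs []       ys = refl
  concatMap-pairs (x ∷ xs) ys = cong (map (x ,_) ys ++_) (concatMap-pairs xs ys)

  dKT≡count : ∀ (L M : Ordering n) → dKT L M ≡ length (filterᵇ (disagreesOn L M) (cartesianProduct (allFin n) (allFin n)))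
  dKT≡count {n} L M = cong (length ∘ filterᵇ (disagreesOn L M)) (concatMap-pairs (allFin n) (allFin n))

  length-cartesianProduct : ∀ {A B : Set} (xs : List A) (ys : List B) →
    length (cartesianProduct xs ys) ≡ length xs * length ys
  length-cartesianProduct []       ys = refl
  length-cartesianProduct (x ∷ xs) ys = begin
    length (map (x ,_) ys ++ cartesianProduct xs ys)        ≡⟨ List.length-++ (map (x ,_) ys) ⟩
    length (map (x ,_) ys) + length (cartesianProduct xs ys) ≡⟨ cong₂ _+_ (List.length-map (x ,_) ys) (length-cartesianProduct xs ys) ⟩
    length ys + length xs * length ys                       ∎
    where open ≡-Reasoning

  cartesianProduct-⊆ : ∀ {A B : Set} {xs xs' : List A} {ys ys' : List B} →
    xs ⊆ xs' → ys ⊆ ys' → cartesianProduct xs ys ⊆ cartesianProduct xs' ys'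
  cartesianProduct-⊆ []                     _  = []⊆-universal _
  cartesianProduct-⊆ {ys' = ys'} (x ∷ʳ xs⊆) ys⊆ = ++⁺ˡ (map (x ,_) ys') (cartesianProduct-⊆ xs⊆ ys⊆)
  cartesianProduct-⊆ (refl ∷ xs⊆)           ys⊆ = ++⁺ (map⁺ _ ys⊆) (cartesianProduct-⊆ xs⊆ ys⊆)

  All-cartesianProduct : ∀ {A B : Set} {P : A × B → Set} {xs ys} →
    All (λ x → All (λ y → P (x , y)) ys) xs → All P (cartesianProduct xs ys)
  All-cartesianProduct []         = []
  All-cartesianProduct (Px ∷ Pxs) = All.++⁺ (All.map⁺ Px) (All-cartesianProduct Pxs)

  length-≤-filterᵇ : ∀ {A : Set} (p : A → Bool) {xs ys} → xs ⊆ ys → All (λ x → p x ≡ true) xs →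
    length xs ≤ length (filterᵇ p ys)
  length-≤-filterᵇ p {xs} {ys} xs⊆ys pxs = begin
    length xs             ≡⟨ cong length (List.filter-all (T? ∘ p) (All.map (Equivalence.from T-≡) pxs)) ⟨
    length (filterᵇ p xs) ≤⟨ length-mono-≤ (filter⁺ (T? ∘ p) (T? ∘ p) (λ { refl → id }) xs⊆ys) ⟩
    length (filterᵇ p ys) ∎
    where open ℕ.≤-Reasoning

  dKT-≥ : ∀ {xs ys} (L M : Ordering n) → allFin n ≡ xs ++ ys →
    All (λ i → All (λ j → disagreesOn L M (i , j) ≡ true) ys) xs → length xs * length ys ≤ dKT L M
  dKT-≥ {n} {xs} {ys} L M allFin≡xs++ys inverted = begin
    length xs * length ys ≡⟨ length-cartesianProduct xs ys ⟨
    length (cartesianProduct xs ys)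
      ≤⟨ length-≤-filterᵇ (disagreesOn L M) (cartesianProduct-⊆ xs⊆ ys⊆) (All-cartesianProduct inverted) ⟩
    length (filterᵇ (disagreesOn L M) (cartesianProduct (allFin n) (allFin n))) ≡⟨ dKT≡count L M ⟨
    dKT L M ∎
    where
    open ℕ.≤-Reasoning
    xs⊆ : xs ⊆ allFin n
    xs⊆ = subst (xs ⊆_) (sym allFin≡xs++ys) (++⁺ʳ ys ⊆-refl)
    ys⊆ : ys ⊆ allFin n
    ys⊆ = subst (ys ⊆_) (sym allFin≡xs++ys) (++⁺ˡ xs ⊆-refl)

  alternating : ∀ {A : Set} → ℕ → A → A → List A
  alternating zero    a b = []
  alternating (suc q) a b = a ∷ b ∷ alternating q a b

  staticCost-alternating : ∀ q (τ : Ordering n) S S' →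
    staticCost τ (alternating q S S') ≡ q * (hit τ S + hit τ S')
  staticCost-alternating zero    τ S S' = refl
  staticCost-alternating (suc q) τ S S' = begin
    hit τ S + (hit τ S' + staticCost τ (alternating q S S')) ≡⟨ ℕ.+-assoc (hit τ S) _ _ ⟨
    hit τ S + hit τ S' + staticCost τ (alternating q S S')   ≡⟨ cong (hit τ S + hit τ S' +_) (staticCost-alternating q τ S S') ⟩
    hit τ S + hit τ S' + q * (hit τ S + hit τ S')           ∎
    where open ≡-Reasoning

  maeCost-2-cycle : ∀ q {L M : Ordering n} S S' → maeStep L S ≡ M → maeStep M S' ≡ L →
    q * (dKT L M + dKT M L) ≤ maeCost L (alternating q S S')
  maeCost-2-cycle zero    _ _ _    _   = z≤n
  maeCost-2-cycle (suc q) {L} {M} S S' refl M→L = begin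
    dKT L M + dKT M L + q * (dKT L M + dKT M L)
      ≤⟨ ℕ.+-monoʳ-≤ (dKT L M + dKT M L) (maeCost-2-cycle q S S' refl M→L) ⟩
    dKT L M + dKT M L + rest
      ≡⟨ ℕ.+-assoc (dKT L M) _ _ ⟩
    dKT L M + (dKT M L + rest)
      ≤⟨ ℕ.+-mono-≤ (ℕ.m≤n+m (dKT L M) (hit L S)) (ℕ.+-monoˡ-≤ rest (ℕ.m≤n+m (dKT M L) (hit M S'))) ⟩
    hit L S + dKT L M + (hit M S' + dKT M L + rest)
      ≡⟨ cong (λ N → hit L S + dKT L M + (hit M S' + dKT M N + maeCost N (alternating q S S'))) (sym M→L) ⟩
    maeCost L (alternating (suc q) S S') ∎
    where
    open ℕ.≤-Reasoning
    rest = maeCost L (alternating q S S')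

  ∣⊤++p∣ : ∀ k (p : Subset n) → ∣ ⊤ {k} Vec.++ p ∣ ≡ k + ∣ p ∣
  ∣⊤++p∣ zero    p = refl
  ∣⊤++p∣ (suc k) p = cong suc (∣⊤++p∣ k p)

  tabulate-↑ : ∀ {A : Set} m k (f : Fin (m + k) → A) →
    tabulate f ≡ tabulate (f ∘ (_↑ˡ k)) ++ tabulate (f ∘ (m ↑ʳ_))
  tabulate-↑ zero    k f = refl
  tabulate-↑ (suc m) k f = cong (f zero ∷_) (tabulate-↑ m k (f ∘ suc))

  ℕ→ℚ≡mkℚ : ∀ m → ℕ→ℚ m ≡ mkℚ (ℤ.+ m) 0 (ℕ.gcd≡1⇒coprime (ℕ.gcd-zeroʳ m))
  ℕ→ℚ≡mkℚ m = ℚ.normalize-coprime (ℕ.gcd≡1⇒coprime (ℕ.gcd-zeroʳ m))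

  ℕ→ℚ-homo-+ : ∀ a b → ℕ→ℚ (a + b) ≡ ℕ→ℚ a ℚ.+ ℕ→ℚ b
  ℕ→ℚ-homo-+ a b = ℚ.toℚᵘ-injective (ℚᵘ.≃-trans toℚᵘ-+ (ℚᵘ.≃-sym (ℚ.toℚᵘ-homo-+ (ℕ→ℚ a) (ℕ→ℚ b))))
    where
    toℚᵘ-+ : ℚ.toℚᵘ (ℕ→ℚ (a + b)) ℚᵘ.≃ ℚ.toℚᵘ (ℕ→ℚ a) ℚᵘ.+ ℚ.toℚᵘ (ℕ→ℚ b)
    toℚᵘ-+ rewrite ℕ→ℚ≡mkℚ a | ℕ→ℚ≡mkℚ b | ℕ→ℚ≡mkℚ (a + b) =
      ℚᵘ.*≡* (cong (ℤ._* ℤ.+ 1) (trans (ℤ.pos-+ a b)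
        (sym (cong₂ ℤ._+_ (ℤ.*-identityʳ (ℤ.+ a)) (ℤ.*-identityʳ (ℤ.+ b))))))

  ℕ→ℚ-homo-* : ∀ a b → ℕ→ℚ (a * b) ≡ ℕ→ℚ a ℚ.* ℕ→ℚ b
  ℕ→ℚ-homo-* a b = ℚ.toℚᵘ-injective (ℚᵘ.≃-trans toℚᵘ-* (ℚᵘ.≃-sym (ℚ.toℚᵘ-homo-* (ℕ→ℚ a) (ℕ→ℚ b))))
    where
    toℚᵘ-* : ℚ.toℚᵘ (ℕ→ℚ (a * b)) ℚᵘ.≃ ℚ.toℚᵘ (ℕ→ℚ a) ℚᵘ.* ℚ.toℚᵘ (ℕ→ℚ b)
    toℚᵘ-* rewrite ℕ→ℚ≡mkℚ a | ℕ→ℚ≡mkℚ b | ℕ→ℚ≡mkℚ (a * b) =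
      ℚᵘ.*≡* (cong (ℤ._* ℤ.+ 1) (ℤ.pos-* a b))

  ℕ→ℚ-mono-< : ∀ {a b} → a < b → ℕ→ℚ a ℚ.< ℕ→ℚ b
  ℕ→ℚ-mono-< {a} {b} a<b rewrite ℕ→ℚ≡mkℚ a | ℕ→ℚ≡mkℚ b =
    ℚ.*<* (subst₂ ℤ._<_ (sym (ℤ.*-identityʳ (ℤ.+ a))) (sym (ℤ.*-identityʳ (ℤ.+ b))) (ℤ.+<+ a<b))

  ℕ→ℚ-nonNeg : ∀ m → ℚ.NonNegative (ℕ→ℚ m)
  ℕ→ℚ-nonNeg m = ℚ.normalize-nonNeg m 1

  ratio-bound : ∀ {c c'} d R q α M → c ℚ.* ℕ→ℚ d ≡ 1ℚ → c' ℚ.< c ℚ.* ℕ→ℚ R →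
    q * R + α < M → c' ℚ.* ℕ→ℚ (q * d) ℚ.+ ℕ→ℚ α ℚ.< ℕ→ℚ M
  ratio-bound {c} {c'} d R q α M cd≡1 c'<cR qR+α<M = begin-strict
    c' ℚ.* ℕ→ℚ (q * d) ℚ.+ ℕ→ℚ α
      ≤⟨ ℚ.+-monoˡ-≤ (ℕ→ℚ α) (ℚ.*-monoʳ-≤-nonNeg (ℕ→ℚ (q * d)) {{ℕ→ℚ-nonNeg (q * d)}} (ℚ.<⇒≤ c'<cR)) ⟩
    c ℚ.* ℕ→ℚ R ℚ.* ℕ→ℚ (q * d) ℚ.+ ℕ→ℚ α
      ≡⟨ cong (ℚ._+ ℕ→ℚ α) cR·qd≡qR ⟩
    ℕ→ℚ (q * R) ℚ.+ ℕ→ℚ α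
      ≡⟨ ℕ→ℚ-homo-+ (q * R) α ⟨
    ℕ→ℚ (q * R + α)
      <⟨ ℕ→ℚ-mono-< qR+α<M ⟩
    ℕ→ℚ M ∎
    where
    open ℚ.≤-Reasoning
    cR·qd≡qR : c ℚ.* ℕ→ℚ R ℚ.* ℕ→ℚ (q * d) ≡ ℕ→ℚ (q * R)
    cR·qd≡qR = begin-equality
      c ℚ.* ℕ→ℚ R ℚ.* ℕ→ℚ (q * d)           ≡⟨ cong (c ℚ.* ℕ→ℚ R ℚ.*_) (trans (ℕ→ℚ-homo-* q d) (ℚ.*-comm (ℕ→ℚ q) (ℕ→ℚ d))) ⟩
      c ℚ.* ℕ→ℚ R ℚ.* (ℕ→ℚ d ℚ.* ℕ→ℚ q)     ≡⟨ interchange c (ℕ→ℚ R) (ℕ→ℚ d) (ℕ→ℚ q) ⟩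
      c ℚ.* ℕ→ℚ d ℚ.* (ℕ→ℚ R ℚ.* ℕ→ℚ q)     ≡⟨ cong (ℚ._* (ℕ→ℚ R ℚ.* ℕ→ℚ q)) cd≡1 ⟩
      1ℚ ℚ.* (ℕ→ℚ R ℚ.* ℕ→ℚ q)              ≡⟨ ℚ.*-identityˡ _ ⟩
      ℕ→ℚ R ℚ.* ℕ→ℚ q                       ≡⟨ trans (cong ℕ→ℚ (ℕ.*-comm q R)) (ℕ→ℚ-homo-* R q) ⟨
      ℕ→ℚ (q * R) ∎

  module Halves (r' : ℕ) where

    r N : ℕ
    r = suc r'
    N = r + r

    lo hi : Ordering N
    lo = tabulate {n = r} (_↑ˡ r)
    hi = tabulate {n = r} (r ↑ʳ_)

    l₀ h₀ : Fin N
    l₀ = zero ↑ˡ r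
    h₀ = r ↑ʳ zero

    ls hs : Ordering N
    ls = tabulate {n = r'} (λ i → suc i ↑ˡ r)
    hs = tabulate {n = r'} (λ j → r ↑ʳ suc j)

    allFin≡lo++hi : allFin N ≡ lo ++ hi
    allFin≡lo++hi = tabulate-↑ r r id

    Lo Hi : Subset N
    Lo = ⊤ {r} Vec.++ ⊥ {r}
    Hi = ∁ Lo

    lo⊆Lo : All (λ x → inS Lo x ≡ true) lo
    lo⊆Lo = All.tabulate⁺ {f = _↑ˡ r} (λ i → trans (Vec.lookup-++ˡ (⊤ {r}) (⊥ {r}) i) (Vec.lookup-replicate i true))

    hi∩Lo=∅ : All (λ x → inS Lo x ≡ false) hi
    hi∩Lo=∅ = All.tabulate⁺ {f = r ↑ʳ_} (λ j → trans (Vec.lookup-++ʳ (⊤ {r}) (⊥ {r}) j) (Vec.lookup-replicate j false))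

    hi⊆Hi : All (λ x → inS Hi x ≡ true) hi
    hi⊆Hi = All.map (λ {x} x∉Lo → trans (inS-∁ Lo x) (cong not x∉Lo)) hi∩Lo=∅

    lo∩Hi=∅ : All (λ x → inS Hi x ≡ false) lo
    lo∩Hi=∅ = All.map (λ {x} x∈Lo → trans (inS-∁ Lo x) (cong not x∈Lo)) lo⊆Lo

    ∣Lo∣≡r : ∣ Lo ∣ ≡ r
    ∣Lo∣≡r = trans (∣⊤++p∣ r ⊥) (trans (cong (r +_) (∣⊥∣≡0 r)) (ℕ.+-identityʳ r))

    ∣Hi∣≡r : ∣ Hi ∣ ≡ r
    ∣Hi∣≡r = trans (∣∁p∣≡n∸∣p∣ Lo) (trans (cong (N ∸_) ∣Lo∣≡r) (ℕ.m+n∸m≡n r r))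

    |lo|≡r : length lo ≡ r
    |lo|≡r = List.length-tabulate {n = r} (_↑ˡ r)

    |hi|≡r : length hi ≡ r
    |hi|≡r = List.length-tabulate {n = r} (r ↑ʳ_)

    lo<r : All (λ x → toℕ x < r) lo
    lo<r = All.tabulate⁺ {f = _↑ˡ r} (λ i → subst (_< r) (sym (toℕ-↑ˡ i r)) (toℕ<n i))

    r≤hi : All (λ x → r ≤ toℕ x) hi
    r≤hi = All.tabulate⁺ {f = r ↑ʳ_} (λ j → subst (r ≤_) (sym (toℕ-↑ʳ r j)) (ℕ.m≤m+n r (toℕ j)))

    L₀ L₁ : Ordering N
    L₀ = hi ++ lo
    L₁ = lo ++ hi

    swap-to-L₁ : maeStep L₀ Lo ≡ L₁
    swap-to-L₁ = maeStep-swap hi l₀ ls Lo (ℕ.≤-trans (ℕ.≤-reflexive |hi|≡r) (ℕ.m≤m+n r r)) hi∩Lo=∅ lo⊆Lo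

    swap-to-L₀ : maeStep L₁ Hi ≡ L₀
    swap-to-L₀ = maeStep-swap lo h₀ hs Hi (ℕ.≤-trans (ℕ.≤-reflexive |lo|≡r) (ℕ.m≤m+n r r)) lo∩Hi=∅ hi⊆Hi

    lo-hi-inverted : ∀ {i j} → i ∈ lo → j ∈ hi → disagreesOn L₁ L₀ (i , j) ≡ true
    lo-hi-inverted {i} {j} i∈lo j∈hi = disagreesOn-inverted L₁ L₀ toℕi<toℕj
      (pos-++-< hi i∈lo (All.map (λ i∉Hi → ∉-≢ Hi i∉Hi (All.lookup hi⊆Hi j∈hi)) lo∩Hi=∅))
      (pos-++-< lo j∈hi (All.map (λ j∉Lo → ∉-≢ Lo j∉Lo (All.lookup lo⊆Lo i∈lo)) hi∩Lo=∅))
      where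
      toℕi<toℕj : toℕ i < toℕ j
      toℕi<toℕj = ℕ.<-≤-trans (All.lookup lo<r i∈lo) (All.lookup r≤hi j∈hi)

    r²≤dKT : ∀ L M → (∀ {i j} → i ∈ lo → j ∈ hi → disagreesOn L M (i , j) ≡ true) → r * r ≤ dKT L M
    r²≤dKT L M inverted = subst₂ (λ a b → a * b ≤ dKT L M) |lo|≡r |hi|≡r
      (dKT-≥ L M allFin≡lo++hi (All.tabulate (λ i∈lo → All.tabulate (inverted i∈lo))))

    swap-cost : r * r + r * r ≤ dKT L₀ L₁ + dKT L₁ L₀
    swap-cost = ℕ.+-mono-≤
      (r²≤dKT L₀ L₁ (λ {i} {j} i∈lo j∈hi → trans (disagreesOn-comm L₀ L₁ (i , j)) (lo-hi-inverted i∈lo j∈hi)))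
      (r²≤dKT L₁ L₀ lo-hi-inverted)

    σ : Ordering N
    σ = h₀ ∷ lo ++ hs

    σ-perm : IsPerm σ
    σ-perm = subst (σ ↭_) (sym allFin≡lo++hi) (↭-sym (shift h₀ lo hs))

    L₀-perm : IsPerm L₀
    L₀-perm = subst (L₀ ↭_) (sym allFin≡lo++hi) (++-comm hi lo)

    σ-cost : hit σ Lo + hit σ Hi ≡ 3
    σ-cost = cong₂ _+_
      (hit-++ (h₀ ∷ []) l₀ (ls ++ hs) Lo (s≤s z≤n) (All.lookup hi∩Lo=∅ (here refl) ∷ []) (All.lookup lo⊆Lo (here refl)))
      (hit-++ [] h₀ (lo ++ hs) Hi z≤n [] (All.lookup hi⊆Hi (here refl)))

    σ-optimal : ∀ τ → IsPerm τ → hit σ Lo + hit σ Hi ≤ hit τ Lo + hit τ Hi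
    σ-optimal []      τ-perm with () ← ↭-length τ-perm
    σ-optimal (x ∷ τ) _      rewrite σ-cost = 3≤hit+hit-∁ x τ Lo

    requests : ℕ → List (Subset N)
    requests q = alternating q Lo Hi

    requests-uniform : ∀ q → All (λ S → ∣ S ∣ ≡ r) (requests q)
    requests-uniform zero    = []
    requests-uniform (suc q) = ∣Lo∣≡r ∷ ∣Hi∣≡r ∷ requests-uniform q

    σ-staticCost : ∀ q → staticCost σ (requests q) ≡ q * 3
    σ-staticCost q = trans (staticCost-alternating q σ Lo Hi) (cong (q *_) σ-cost)

    σ-static-optimal : ∀ q τ → IsPerm τ → staticCost σ (requests q) ≤ staticCost τ (requests q)
    σ-static-optimal q τ τ-perm = subst₂ _≤_
      (sym (staticCost-alternating q σ Lo Hi)) (sym (staticCost-alternating q τ Lo Hi))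
      (ℕ.*-monoʳ-≤ q (σ-optimal τ τ-perm))

    maeCost-exceeds : ∀ α → suc α * (r * r) + α < maeCost L₀ (requests (suc α))
    maeCost-exceeds α = begin-strict
      q * R + α                   <⟨ ℕ.+-monoʳ-< (q * R) (ℕ.<-≤-trans (ℕ.n<1+n α) (ℕ.m≤m*n q R)) ⟩
      q * R + q * R               ≡⟨ ℕ.*-distribˡ-+ q R R ⟨
      q * (R + R)                 ≤⟨ ℕ.*-monoʳ-≤ q swap-cost ⟩
      q * (dKT L₀ L₁ + dKT L₁ L₀) ≤⟨ maeCost-2-cycle q Lo Hi swap-to-L₁ swap-to-L₀ ⟩
      maeCost L₀ (requests q)     ∎
      where
      open ℕ.≤-Reasoning
      q = suc α
      R = r * r

open MoveAllEqually using (ratio-bound; module Halves)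

open import Data.Nat using (ℕ; suc; _≥_; _*_; _≤_)
open import Data.Fin.Subset using (Subset; ∣_∣)
open import Data.List using (List)
open import Data.List.Relation.Unary.All using (All)
open import Data.Product using (Σ; ∃-syntax; _×_; _,_)
open import Data.Rational using (ℚ; _<_; _+_; _/_; Positive) renaming (_*_ to _*ℚ_)
open import Data.Integer using (+_)
open import Relation.Binary.PropositionalEquality using (_≡_; refl; sym; subst)

theorem3 : Σ ℚ λ c → Positive c ×
    ((r : ℕ) → r ≥ 1 → ∃[ n ] ((c' : ℚ) → c' < c *ℚ ℕ→ℚ (r * r) → (α : ℕ) →
      Σ (Ordering n) λ π₀ → IsPerm π₀ ×
      Σ (List (Subset n)) λ Ss → All (λ S → ∣ S ∣ ≡ r) Ss ×
      Σ (Ordering n) λ σ → IsPerm σ ×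
        ((τ : Ordering n) → IsPerm τ → staticCost σ Ss ≤ staticCost τ Ss) ×
        (c' *ℚ ℕ→ℚ (staticCost σ Ss) + ℕ→ℚ α < ℕ→ℚ (maeCost π₀ Ss))))
theorem3 = + 1 / 3 , _ , λ where
  (suc r') _ → let open Halves r' in N , λ c' c'<⅓r² α →
    L₀ , L₀-perm , requests (suc α) , requests-uniform (suc α) , σ , σ-perm , σ-static-optimal (suc α) ,
    subst (λ s → c' *ℚ ℕ→ℚ s + ℕ→ℚ α < ℕ→ℚ (maeCost L₀ (requests (suc α)))) (sym (σ-staticCost (suc α)))
      (ratio-bound 3 (r * r) (suc α) α _ refl c'<⅓r² (maeCost-exceeds α))
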